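{- For every two graphs $G$ and $H$, $\Gamma(G[H])\ge \alpha(G)\,\Gamma(H)$.
   Context: $\Gamma$ denotes the upper domination number (maximum size of an inclusion-minimal dominating set), $\alpha$ the independence number. The lexicographic product $G[H]$ has vertex set $V(G)\times V(H)$, with $(x_1,y_1)$ adjacent to $(x_2,y_2)$ iff $x_1x_2\in E(G)$, or $x_1=x_2$ and $y_1y_2\in E(H)$. -}

module Defs where

open import Level using (0ℓ)
open import Data.Nat using (ℕ; _≤_)
open import Data.Fin using (Fin; remQuot)
open import Data.Fin.Subset using (Subset; _∈_; _⊂_; ∣_∣)
open import Data.Product using (Σ; _×_; _,_; proj₁; proj₂; ∃)
open import Data.Sum using (_⊎_)
open import Relation.Nullary using (¬_)
open import Relation.Binary.PropositionalEquality using (_≡_)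

record Graph : Set₁ where
  field
    n      : ℕ
    Adj    : Fin n → Fin n → Set
    sym    : ∀ {u v} → Adj u v → Adj v u
    irrefl : ∀ {u} → ¬ Adj u u

open Graph public

Independent : (G : Graph) → Subset (n G) → Set
Independent G S = ∀ u v → u ∈ S → v ∈ S → ¬ Adj G u v

Dominating : (G : Graph) → Subset (n G) → Set
Dominating G S = ∀ v → v ∈ S ⊎ (Σ (Fin (n G)) λ u → u ∈ S × Adj G u v)

MinimalDominating : (G : Graph) → Subset (n G) → Set
MinimalDominating G S = Dominating G S × (∀ T → T ⊂ S → ¬ Dominating G T)

IsMaxCard : ∀ {m} → (Subset m → Set) → ℕ → Set
IsMaxCard {m} P k = (Σ (Subset m) λ S → P S × ∣ S ∣ ≡ k) × (∀ S → P S → ∣ S ∣ ≤ k)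

IsIndependenceNumber : Graph → ℕ → Set
IsIndependenceNumber G k = IsMaxCard (Independent G) k

IsUpperDominationNumber : Graph → ℕ → Set
IsUpperDominationNumber G k = IsMaxCard (MinimalDominating G) k

-- Lexicographic product G[H] on Fin (n G * n H), vertex i ↔ remQuot i = (x , y)
lexAdj : (G H : Graph) → Fin (n G Data.Nat.* n H) → Fin (n G Data.Nat.* n H) → Set
lexAdj G H i j =
  Adj G (proj₁ (remQuot {n G} (n H) i)) (proj₁ (remQuot {n G} (n H) j))
  ⊎ (proj₁ (remQuot {n G} (n H) i) ≡ proj₁ (remQuot {n G} (n H) j)
     × Adj H (proj₂ (remQuot {n G} (n H) i)) (proj₂ (remQuot {n G} (n H) j)))

lexAdj-sym : (G H : Graph) → ∀ {i j} → lexAdj G H i j → lexAdj G H j i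
lexAdj-sym G H (Data.Sum.inj₁ a) = Data.Sum.inj₁ (sym G a)
lexAdj-sym G H (Data.Sum.inj₂ (e , a)) =
  Data.Sum.inj₂ (Relation.Binary.PropositionalEquality.sym e , sym H a)

lexAdj-irrefl : (G H : Graph) → ∀ {i} → ¬ lexAdj G H i i
lexAdj-irrefl G H (Data.Sum.inj₁ a) = irrefl G a
lexAdj-irrefl G H (Data.Sum.inj₂ (_ , a)) = irrefl H a

lex : Graph → Graph → Graph
lex G H = record
  { n = n G Data.Nat.* n H
  ; Adj = lexAdj G H
  ; sym = lexAdj-sym G H
  ; irrefl = lexAdj-irrefl G H
  }

-- A maximum independent set I of G is dominating, and for a maximum minimal
-- dominating set D of H the product I × D dominates G[H]. It is even minimal:
-- if T ⊂ I × D misses (u , d), then the fibre {y ∣ (u , y) ∈ T} still dominates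
-- H, because independence of I prevents the other fibres of T from dominating
-- the vertices (u , y); so this fibre would be a proper dominating subset of D.
-- Hence Γ(G[H]) ≥ ∣I × D∣ = α(G) Γ(H). As adjacency is not assumed decidable,
-- that I dominates G is only obtained up to double negation, which suffices
-- because the conclusion is decidable.
module Submission where

open import Defs hiding (sym)
open import Data.Nat using (ℕ; zero; suc; _*_; _+_; _≤_; _<_; _≤?_)
open import Data.Nat.Properties using (<-irrefl; <-≤-trans)
open import Data.Bool using (Bool; true; false; if_then_else_)
open import Data.Fin using (Fin; zero; suc; combine)
open import Data.Fin.Properties using (remQuot-combine; combine-surjective)
open import Data.Fin.Subset using (Subset; _∈_; _⊆_; _⊂_; ∣_∣; ⊥; _∪_; ⁅_⁆)
open import Data.Fin.Subset.Properties
  using (∣⊥∣≡0; p⊂q⇒∣p∣<∣q∣; x∈p∪q⁻; x∈p∪q⁺; x∈⁅x⁆; x∈⁅y⁆⇒x≡y; ∉⊥; p⊆p∪q)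
open import Data.Vec using ([]; _∷_; lookup; tabulate; concat; map; _++_)
open import Data.Vec.Properties
  using (lookup-concat; lookup-map; lookup∘tabulate; []=⇒lookup; lookup⇒[]=)
open import Data.Product using (Σ; _×_; _,_; proj₁; proj₂)
open import Data.Sum using (_⊎_; inj₁; inj₂)
open import Function using (id)
open import Relation.Nullary using (¬_; contradiction)
open import Relation.Nullary.Negation using (¬¬-map)
open import Relation.Nullary.Decidable using (decidable-stable)
open import Relation.Binary.PropositionalEquality
  using (_≡_; refl; sym; trans; cong; subst; subst₂; cong₂; module ≡-Reasoning)

¬¬-∀-Fin : ∀ {m} {P : Fin m → Set} → (∀ x → ¬ ¬ P x) → ¬ ¬ (∀ x → P x)
¬¬-∀-Fin {zero}      f ¬all = ¬all (λ ())
¬¬-∀-Fin {suc m} {P} f ¬all =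
  f zero λ p₀ → ¬¬-∀-Fin {m} {λ x → P (suc x)} (λ x → f (suc x)) λ ps →
    ¬all λ { zero → p₀ ; (suc x) → ps x }

∣p++q∣≡∣p∣+∣q∣ : ∀ {m n} (p : Subset m) (q : Subset n) → ∣ p ++ q ∣ ≡ ∣ p ∣ + ∣ q ∣
∣p++q∣≡∣p∣+∣q∣ []          q = refl
∣p++q∣≡∣p∣+∣q∣ (true ∷ p)  q = cong suc (∣p++q∣≡∣p∣+∣q∣ p q)
∣p++q∣≡∣p∣+∣q∣ (false ∷ p) q = ∣p++q∣≡∣p∣+∣q∣ p q

infixr 7 _⊗_
infixr 8 _·_

_·_ : ∀ {n} → Bool → Subset n → Subset n
b · q = if b then q else ⊥

_⊗_ : ∀ {m n} → Subset m → Subset n → Subset (m * n)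
p ⊗ q = concat (map (_· q) p)

fibre : ∀ {m n} → Subset (m * n) → Fin m → Subset n
fibre t x = tabulate (λ y → lookup t (combine x y))

∣p⊗q∣≡∣p∣*∣q∣ : ∀ {m n} (p : Subset m) (q : Subset n) → ∣ p ⊗ q ∣ ≡ ∣ p ∣ * ∣ q ∣
∣p⊗q∣≡∣p∣*∣q∣ []          q = refl
∣p⊗q∣≡∣p∣*∣q∣ (true ∷ p)  q =
  trans (∣p++q∣≡∣p∣+∣q∣ q (p ⊗ q)) (cong (∣ q ∣ +_) (∣p⊗q∣≡∣p∣*∣q∣ p q))
∣p⊗q∣≡∣p∣*∣q∣ {n = n} (false ∷ p) q = begin
  ∣ ⊥ {n} ++ p ⊗ q ∣    ≡⟨ ∣p++q∣≡∣p∣+∣q∣ (⊥ {n}) (p ⊗ q) ⟩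
  ∣ ⊥ {n} ∣ + ∣ p ⊗ q ∣  ≡⟨ cong (_+ ∣ p ⊗ q ∣) (∣⊥∣≡0 n) ⟩
  ∣ p ⊗ q ∣             ≡⟨ ∣p⊗q∣≡∣p∣*∣q∣ p q ⟩
  ∣ p ∣ * ∣ q ∣          ∎
  where open ≡-Reasoning

module _ {m n} {p : Subset m} {q : Subset n} (x : Fin m) {y : Fin n} where

  private
    lookup-⊗ : lookup (p ⊗ q) (combine x y) ≡ lookup (lookup p x · q) y
    lookup-⊗ = begin
      lookup (p ⊗ q) (combine x y)         ≡⟨ lookup-concat (map (_· q) p) x y ⟩
      lookup (lookup (map (_· q) p) x) y   ≡⟨ cong (λ r → lookup r y) (lookup-map x (_· q) p) ⟩
      lookup (lookup p x · q) y            ∎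
      where open ≡-Reasoning

  ∈⊗⁺ : x ∈ p → y ∈ q → combine x y ∈ p ⊗ q
  ∈⊗⁺ x∈p y∈q = lookup⇒[]= _ (p ⊗ q) (begin
    lookup (p ⊗ q) (combine x y)  ≡⟨ lookup-⊗ ⟩
    lookup (lookup p x · q) y     ≡⟨ cong (λ b → lookup (b · q) y) ([]=⇒lookup x∈p) ⟩
    lookup q y                    ≡⟨ []=⇒lookup y∈q ⟩
    true                          ∎)
    where open ≡-Reasoning

  ∈⊗⁻ : combine x y ∈ p ⊗ q → x ∈ p × y ∈ q
  ∈⊗⁻ xy∈p⊗q = row⁻ (lookup p x) refl (trans (sym lookup-⊗) ([]=⇒lookup xy∈p⊗q))
    where
    row⁻ : ∀ b → lookup p x ≡ b → lookup (b · q) y ≡ true → x ∈ p × y ∈ q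
    row⁻ true  px≡b eq = lookup⇒[]= x p px≡b , lookup⇒[]= y q eq
    row⁻ false _    eq = contradiction (lookup⇒[]= y ⊥ eq) ∉⊥

module _ {m n} {t : Subset (m * n)} (x : Fin m) {y : Fin n} where

  ∈fibre⁺ : combine x y ∈ t → y ∈ fibre t x
  ∈fibre⁺ xy∈t = lookup⇒[]= y (fibre t x)
    (trans (lookup∘tabulate _ y) ([]=⇒lookup xy∈t))

  ∈fibre⁻ : y ∈ fibre t x → combine x y ∈ t
  ∈fibre⁻ y∈t[x] = lookup⇒[]= (combine x y) t
    (trans (sym (lookup∘tabulate _ y)) ([]=⇒lookup y∈t[x]))

dominating⇒nonempty : ∀ (G : Graph) {D} → Dominating G D → Fin (n G) → Σ (Fin (n G)) (_∈ D)
dominating⇒nonempty G domD v with domD v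
... | inj₁ v∈D           = v , v∈D
... | inj₂ (u , u∈D , _) = u , u∈D

maximum-independent⇒¬¬dominating : ∀ (G : Graph) {I} → Independent G I →
  (∀ S → Independent G S → ∣ S ∣ ≤ ∣ I ∣) → ¬ ¬ Dominating G I
maximum-independent⇒¬¬dominating G {I} indI maxI = ¬¬-∀-Fin ¬¬dominated
  where
  ¬¬dominated : ∀ x → ¬ ¬ (x ∈ I ⊎ Σ (Fin (n G)) λ u → u ∈ I × Adj G u x)
  ¬¬dominated x undominated = <-irrefl refl (<-≤-trans ∣I∣<∣I′∣ (maxI I′ indI′))
    where
    I′ = I ∪ ⁅ x ⁆
    ∣I∣<∣I′∣ : ∣ I ∣ < ∣ I′ ∣
    ∣I∣<∣I′∣ = p⊂q⇒∣p∣<∣q∣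
      (p⊆p∪q ⁅ x ⁆ , x , x∈p∪q⁺ (inj₂ (x∈⁅x⁆ x)) , λ x∈I → undominated (inj₁ x∈I))
    indI′ : Independent G I′
    indI′ u v u∈I′ v∈I′ with x∈p∪q⁻ I ⁅ x ⁆ u∈I′ | x∈p∪q⁻ I ⁅ x ⁆ v∈I′
    ... | inj₁ u∈I | inj₁ v∈I = indI u v u∈I v∈I
    ... | inj₁ u∈I | inj₂ v∈x = λ u~v →
      undominated (inj₂ (u , u∈I , subst (Adj G u) (x∈⁅y⁆⇒x≡y x v∈x) u~v))
    ... | inj₂ u∈x | inj₁ v∈I = λ u~v →
      undominated (inj₂ (v , v∈I , subst (Adj G v) (x∈⁅y⁆⇒x≡y x u∈x) (Graph.sym G u~v)))
    ... | inj₂ u∈x | inj₂ v∈x = λ u~v →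
      irrefl G (subst₂ (Adj G) (x∈⁅y⁆⇒x≡y x u∈x) (x∈⁅y⁆⇒x≡y x v∈x) u~v)

module _ (G H : Graph) where

  lexAdj-combine : ∀ x y x′ y′ →
    Adj (lex G H) (combine x y) (combine x′ y′) ≡ (Adj G x x′ ⊎ (x ≡ x′ × Adj H y y′))
  lexAdj-combine x y x′ y′ =
    cong₂ adjacentPairs (remQuot-combine {n G} {n H} x y) (remQuot-combine {n G} {n H} x′ y′)
    where
    adjacentPairs : Fin (n G) × Fin (n H) → Fin (n G) × Fin (n H) → Set
    adjacentPairs (x , y) (x′ , y′) = Adj G x x′ ⊎ (x ≡ x′ × Adj H y y′)

  module _ {x x′ : Fin (n G)} {y y′ : Fin (n H)} where

    lex-adjˡ : Adj G x x′ → Adj (lex G H) (combine x y) (combine x′ y′)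
    lex-adjˡ x~x′ = subst id (sym (lexAdj-combine x y x′ y′)) (inj₁ x~x′)

    lex-adj⁻ : Adj (lex G H) (combine x y) (combine x′ y′) → Adj G x x′ ⊎ (x ≡ x′ × Adj H y y′)
    lex-adj⁻ = subst id (lexAdj-combine x y x′ y′)

  lex-adjʳ : ∀ {x y y′} → Adj H y y′ → Adj (lex G H) (combine x y) (combine x y′)
  lex-adjʳ {x} {y} {y′} y~y′ =
    subst id (sym (lexAdj-combine x y x y′)) (inj₂ (refl , y~y′))

  module _ {I : Subset (n G)} {D : Subset (n H)} where

    ⊗-dominating : Dominating G I → Dominating H D → Dominating (lex G H) (I ⊗ D)
    ⊗-dominating domI domD v with combine-surjective {n G} {n H} v
    ... | x , y , refl with domI x
    ...   | inj₂ (u , u∈I , u~x) =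
      let d , d∈D = dominating⇒nonempty H domD y in
      inj₂ (combine u d , ∈⊗⁺ u u∈I d∈D , lex-adjˡ u~x)
    ...   | inj₁ x∈I with domD y
    ...     | inj₁ y∈D             = inj₁ (∈⊗⁺ x x∈I y∈D)
    ...     | inj₂ (d , d∈D , d~y) = inj₂ (combine x d , ∈⊗⁺ x x∈I d∈D , lex-adjʳ d~y)

    fibre-dominating : Independent G I → ∀ {T} → T ⊆ I ⊗ D → Dominating (lex G H) T →
      ∀ {u} → u ∈ I → Dominating H (fibre T u)
    fibre-dominating indI {T} T⊆I⊗D domT {u} u∈I y with domT (combine u y)
    ... | inj₁ uy∈T = inj₁ (∈fibre⁺ u uy∈T)
    ... | inj₂ (w , w∈T , w~uy) with combine-surjective {n G} {n H} w
    ...   | x , z , refl with lex-adj⁻ w~uy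
    ...     | inj₁ x~u         = contradiction x~u (indI x u (proj₁ (∈⊗⁻ x (T⊆I⊗D w∈T))) u∈I)
    ...     | inj₂ (refl , z~y) = inj₂ (z , ∈fibre⁺ u w∈T , z~y)

    ⊗-minimalDominating : Independent G I → Dominating G I → MinimalDominating H D →
      MinimalDominating (lex G H) (I ⊗ D)
    ⊗-minimalDominating indI domI (domD , minD) = ⊗-dominating domI domD , minimal
      where
      minimal : ∀ T → T ⊂ I ⊗ D → ¬ Dominating (lex G H) T
      minimal T (T⊆I⊗D , i , i∈I⊗D , i∉T) domT with combine-surjective {n G} {n H} i
      ... | u , d , refl = minD (fibre T u) (fibre⊆D , d , d∈D , d∉fibre)
                                (fibre-dominating indI T⊆I⊗D domT u∈I)
        where
        u∈I : u ∈ I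
        u∈I = proj₁ (∈⊗⁻ u i∈I⊗D)
        d∈D : d ∈ D
        d∈D = proj₂ (∈⊗⁻ {p = I} u i∈I⊗D)
        fibre⊆D : fibre T u ⊆ D
        fibre⊆D y∈ = proj₂ (∈⊗⁻ {p = I} u (T⊆I⊗D (∈fibre⁻ u y∈)))
        d∉fibre : ¬ d ∈ fibre T u
        d∉fibre d∈ = i∉T (∈fibre⁻ u d∈)

proposition10 : (G H : Graph) (a g k : ℕ) →
    IsIndependenceNumber G a →
    IsUpperDominationNumber H g →
    IsUpperDominationNumber (lex G H) k →
    a * g ≤ k
proposition10 G H a g k ((I , indI , ∣I∣≡a) , maxI) ((D , minD , ∣D∣≡g) , _) (_ , maxLex) =
  decidable-stable (a * g ≤? k) (¬¬-map bound ¬¬domI)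
  where
  ¬¬domI : ¬ ¬ Dominating G I
  ¬¬domI = maximum-independent⇒¬¬dominating G indI
    λ S indS → subst (∣ S ∣ ≤_) (sym ∣I∣≡a) (maxI S indS)
  ∣I⊗D∣≡a*g : ∣ I ⊗ D ∣ ≡ a * g
  ∣I⊗D∣≡a*g = trans (∣p⊗q∣≡∣p∣*∣q∣ I D) (cong₂ _*_ ∣I∣≡a ∣D∣≡g)
  bound : Dominating G I → a * g ≤ k
  bound domI = subst (_≤ k) ∣I⊗D∣≡a*g (maxLex (I ⊗ D) (⊗-minimalDominating G H indI domI minD))
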